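{- Let $\Gamma$ be a connected cubic girth-regular graph of girth $3$. Then either $\Gamma$ is isomorphic to the complete graph $K_4$, or $\Gamma$ has signature $(0,1,1)$ and is isomorphic to the truncation of a cubic graph.
   Context: $\Gamma$ is a finite simple graph; cubic means $3$-regular. For a graph of finite girth $g$, a girth cycle is a cycle of length $g$, and $\epsilon(e)$ is the number of girth cycles containing the edge $e$. The signature of a vertex $v$ with incident edges $e_1,\ldots,e_k$ ordered so that $\epsilon(e_1)\le\cdots\le\epsilon(e_k)$ is $(\epsilon(e_1),\ldots,\epsilon(e_k))$; a graph is girth-regular if all vertices have the same signature (the signature of the graph). Here the cubic graph $\Lambda$ being truncated may have parallel edges: it is a triple $(V,E,\partial)$, each edge consisting of two mutually inverse arcs with tails, $\mathrm{out}(u)$ the arcs with tail $u$, $|\mathrm{out}(u)|=3$. A dihedral scheme is an irreflexive symmetric relation $\leftrightarrow$ on arcs such that (arcs, $\leftrightarrow$) is a $2$-regular simple graph with components exactly the sets $\mathrm{out}(u)$; a cubic graph has a unique one (each $\mathrm{out}(u)$ forms a triangle). The truncation of $\Lambda$ is the simple graph with vertex set the arcs of $\Lambda$, two arcs adjacent iff $s\leftrightarrow t$ or they are mutually inverse. -}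

module Defs where

open import Data.Nat using (ℕ)
open import Data.Nat.Properties using (≤-decTotalOrder)
open import Data.Fin using (Fin)
open import Data.List using (List; []; _∷_; length; filter; map; allFin)
open import Data.List.Sort.MergeSort ≤-decTotalOrder using (sort)
open import Data.Product using (Σ; ∃; _×_; _,_)
open import Data.Sum using (_⊎_)
open import Function.Bundles using (_↔_; Inverse)
open import Relation.Nullary using (¬_)
open import Relation.Nullary.Decidable using (_×-dec_)
open import Relation.Binary using (Rel; Decidable; Symmetric)
open import Relation.Binary.PropositionalEquality using (_≡_; _≢_)
open import Relation.Binary.Construct.Closure.ReflexiveTransitive using (Star)

record Graph : Set₁ where
  field
    n      : ℕ
    Adj    : Rel (Fin n) _
    adj?   : Decidable Adj
    sym    : Symmetric Adj
    irrefl : ∀ {u} → ¬ Adj u u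

module _ (Γ : Graph) where
  open Graph Γ

  nbrs : Fin n → List (Fin n)
  nbrs v = filter (adj? v) (allFin n)

  degree : Fin n → ℕ
  degree v = length (nbrs v)

  Cubic : Set
  Cubic = ∀ v → degree v ≡ 3

  Connected : Set
  Connected = ∀ u v → Star Adj u v

  -- In a simple graph every cycle has length ≥ 3, so the girth is 3
  -- iff there is a cycle of length 3 (a triangle).
  HasGirth3 : Set
  HasGirth3 = ∃ λ u → ∃ λ v → ∃ λ w → Adj u v × Adj v w × Adj u w

  -- For girth 3, girth cycles are triangles; the triangles through the
  -- edge uv are exactly {u,v,w} for w a common neighbour of u and v.
  -- ε u v = number of girth cycles (triangles) containing edge uv.
  ε : Fin n → Fin n → ℕ
  ε u v = length (filter (λ w → adj? u w ×-dec adj? v w) (allFin n))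

  signature : Fin n → List ℕ
  signature v = sort (map (ε v) (nbrs v))

  GirthRegular : Set
  GirthRegular = ∀ u v → signature u ≡ signature v

  HasSignature : List ℕ → Set
  HasSignature σ = ∀ v → signature v ≡ σ

Iso : ∀ {n m} → Rel (Fin n) _ → Rel (Fin m) _ → Set
Iso {n} {m} A B =
  Σ (Fin n ↔ Fin m) λ f →
    ∀ u v → (A u v → B (Inverse.to f u) (Inverse.to f v))
          × (B (Inverse.to f u) (Inverse.to f v) → A u v)

K4-Adj : Rel (Fin 4) _
K4-Adj u v = u ≢ v

-- Cubic (multi)graphs Λ, possibly with parallel edges (no loops).
-- Arcs: Fin na; edges = orbits of the fixed-point-free involution inv
-- (the two mutually inverse arcs of an edge); tail gives the tail.

record CubicMultigraph : Set where
  field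
    nv    : ℕ
    na    : ℕ
    tail  : Fin na → Fin nv
    inv   : Fin na → Fin na
    inv-invol : ∀ a → inv (inv a) ≡ a
    inv-nofix : ∀ a → inv a ≢ a
    noLoops   : ∀ a → tail (inv a) ≢ tail a
    out3  : ∀ u → length (filter (λ a → tail a Data.Fin.≟ u) (allFin na)) ≡ 3

module _ (Λ : CubicMultigraph) where
  open CubicMultigraph Λ

  -- The unique dihedral scheme of a cubic graph: out(u) is a triangle,
  -- i.e. distinct arcs with the same tail are related.
  _↔ᵈ_ : Rel (Fin na) _
  s ↔ᵈ t = s ≢ t × tail s ≡ tail t

  TruncAdj : Rel (Fin na) _
  TruncAdj s t = (s ↔ᵈ t) ⊎ (inv s ≡ t)

IsoToTruncation : Graph → Set
IsoToTruncation Γ =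
  Σ CubicMultigraph λ Λ → Iso (Graph.Adj Γ) (TruncAdj Λ)

-- Let Γ be cubic.  Every vertex x has exactly three neighbours a, b, c, and
-- the number of girth cycles (triangles) through an edge xa is the number of
-- neighbours of a among b, c.  Hence the signature of x is determined by the
-- number k ∈ {0,1,2,3} of edges among the neighbours of x (its local type):
--   k = 0 : (0,0,0),   k = 1 : (0,1,1),   k = 2 : (1,1,2),   k = 3 : (2,2,2),
-- and k can be read off the signature (k = half the sum of its entries), so in
-- a girth-regular graph all vertices have the same local type.  Then
--   * type 0 is excluded by the presence of a triangle;
--   * type 2 cannot hold at all vertices: if x has neighbours a, b, c with
--     a ~ b, a ~ c, b ≁ c, then the only edge among the neighbours of b is xa;
--   * type 3 makes {x,a,b,c} a clique closed under adjacency, which is the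
--     whole graph by connectivity: Γ ≅ K₄;
--   * type 1 means every vertex lies on exactly one triangle; the triangles
--     partition the vertices, and Γ is the truncation of the cubic multigraph
--     whose vertices are the triangles and whose arcs are the vertices of Γ,
--     the inverse of an arc x being its neighbour outside its triangle.

module Submission where

open import Defs
open import Data.Nat using (ℕ)
open import Data.List using (List; []; _∷_)
open import Data.Product using (_×_)
open import Data.Sum using (_⊎_)

import Algebra.Construct.NaturalChoice.Min as Min
open import Data.Bool using (true; false; if_then_else_)
open import Data.Empty using (⊥; ⊥-elim)
open import Data.Fin using (Fin; zero; suc; _≟_; _≤_)
open import Data.Fin.Patterns using (0F; 1F; 2F; 3F)
open import Data.Fin.Properties using (≤-totalOrder; ≤-trans; ≤-antisym)
open import Data.List using (length; filter; map; lookup; allFin)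
open import Data.List.Membership.Propositional using (_∈_; lose)
open import Data.List.Membership.Propositional.Properties
  using (∈-filter⁺; ∈-filter⁻; ∈-allFin; ∈-lookup)
open import Data.List.Membership.Propositional.Properties.WithK using (unique⇒irrelevant; unique∧set⇒bag)
open import Data.List.Properties using (filter-notAll)
open import Data.List.Relation.Binary.BagAndSetEquality using (∼bag⇒↭)
open import Data.List.Relation.Binary.Permutation.Propositional.Properties using (↭-length)
open import Data.List.Relation.Unary.All using ([]; _∷_)
open import Data.List.Relation.Unary.AllPairs using ([]; _∷_)
open import Data.List.Relation.Unary.Any using (here; there; index)
open import Data.List.Relation.Unary.Any.Properties using (lookup-index)
open import Data.List.Relation.Unary.Unique.Propositional using (Unique)
open import Data.List.Relation.Unary.Unique.Propositional.Properties using (filter⁺; allFin⁺)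
open import Data.Nat using (suc; _+_; _<_; ⌊_/2⌋)
open import Data.Nat.ListAction using (sum)
open import Data.Nat.Properties using (<-irrefl; ≤-decTotalOrder)
open import Data.List.Sort.MergeSort ≤-decTotalOrder using (sort)
open import Data.Product using (Σ; ∃; _,_; proj₂)
open import Data.Sum using (inj₁; inj₂)
open import Function.Bundles using (mk⇔; mk↔ₛ′)
open import Function.Construct.Identity using (↔-id)
open import Relation.Binary.Construct.Closure.ReflexiveTransitive using (Star; _◅_) renaming (ε to done)
open import Relation.Binary.PropositionalEquality
  using (_≡_; _≢_; refl; sym; trans; cong; cong₂; subst; subst₂; ≢-sym; module ≡-Reasoning)
open import Relation.Nullary using (¬_; Dec; yes; no; does)
open import Relation.Nullary.Decidable using (_×-dec_; _⊎-dec_; map′)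
open import Relation.Unary using (Decidable)

OneOf : {A : Set} → A → A → A → A → Set
OneOf z a b c = z ≡ a ⊎ z ≡ b ⊎ z ≡ c

oneOf? : ∀ {n} (z a b c : Fin n) → Dec (OneOf z a b c)
oneOf? z a b c = (z ≟ a) ⊎-dec ((z ≟ b) ⊎-dec (z ≟ c))

module _ {A : Set} where

  oneOf⇒∈ : ∀ {z a b c : A} → OneOf z a b c → z ∈ a ∷ b ∷ c ∷ []
  oneOf⇒∈ (inj₁ refl)        = here refl
  oneOf⇒∈ (inj₂ (inj₁ refl)) = there (here refl)
  oneOf⇒∈ (inj₂ (inj₂ refl)) = there (there (here refl))

  ∈⇒oneOf : ∀ {z a b c : A} → z ∈ a ∷ b ∷ c ∷ [] → OneOf z a b c
  ∈⇒oneOf (here z≡a)                = inj₁ z≡a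
  ∈⇒oneOf (there (here z≡b))        = inj₂ (inj₁ z≡b)
  ∈⇒oneOf (there (there (here z≡c))) = inj₂ (inj₂ z≡c)
  ∈⇒oneOf (there (there (there ())))

  triple-unique : ∀ {a b c : A} → a ≢ b → a ≢ c → b ≢ c → Unique (a ∷ b ∷ c ∷ [])
  triple-unique a≢b a≢c b≢c = (a≢b ∷ a≢c ∷ []) ∷ (b≢c ∷ []) ∷ [] ∷ []

  no-three-in-two : ∀ {x y z u v : A} → x ≢ y → x ≢ z → y ≢ z →
                    x ≡ u ⊎ x ≡ v → y ≡ u ⊎ y ≡ v → z ≡ u ⊎ z ≡ v → ⊥
  no-three-in-two x≢y _   _   (inj₁ refl) (inj₁ refl) _           = x≢y refl
  no-three-in-two x≢y _   _   (inj₂ refl) (inj₂ refl) _           = x≢y refl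
  no-three-in-two _   x≢z _   (inj₁ refl) (inj₂ refl) (inj₁ refl) = x≢z refl
  no-three-in-two _   _   y≢z (inj₁ refl) (inj₂ refl) (inj₂ refl) = y≢z refl
  no-three-in-two _   _   y≢z (inj₂ refl) (inj₁ refl) (inj₁ refl) = y≢z refl
  no-three-in-two _   x≢z _   (inj₂ refl) (inj₁ refl) (inj₂ refl) = x≢z refl

  same-members⇒same-length : ∀ {xs ys : List A} → Unique xs → Unique ys →
    (∀ {z} → z ∈ xs → z ∈ ys) → (∀ {z} → z ∈ ys → z ∈ xs) → length xs ≡ length ys
  same-members⇒same-length uxs uys xs⊆ys ys⊆xs =
    ↭-length (∼bag⇒↭ (unique∧set⇒bag uxs uys (mk⇔ xs⊆ys ys⊆xs)))

  index-of-lookup : ∀ {xs : List A} {x} → Unique xs → (x∈xs : x ∈ xs) (i : Fin (length xs)) →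
                    x ≡ lookup xs i → index x∈xs ≡ i
  index-of-lookup {xs} uxs x∈xs i refl =
    trans (cong index (unique⇒irrelevant uxs x∈xs (∈-lookup i))) (index-∈-lookup xs i)
    where
    index-∈-lookup : ∀ xs (i : Fin (length xs)) → index (∈-lookup {xs = xs} i) ≡ i
    index-∈-lookup (_ ∷ _)  zero    = refl
    index-∈-lookup (_ ∷ xs) (suc i) = cong suc (index-∈-lookup xs i)

indicator : {A : Set} → Dec A → ℕ
indicator d = if does d then 1 else 0

indicator-irrelevant : {A : Set} (d d′ : Dec A) → indicator d ≡ indicator d′
indicator-irrelevant (yes _) (yes _) = refl
indicator-irrelevant (no _)  (no _)  = refl
indicator-irrelevant (yes a) (no ¬a) = ⊥-elim (¬a a)
indicator-irrelevant (no ¬a) (yes a) = ⊥-elim (¬a a)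

length-filter-pair : {A : Set} {P : A → Set} (P? : Decidable P) (u v : A) →
                     length (filter P? (u ∷ v ∷ [])) ≡ indicator (P? u) + indicator (P? v)
length-filter-pair P? u v with does (P? u)
... | true  with does (P? v)
...   | true  = refl
...   | false = refl
length-filter-pair P? u v | false with does (P? v)
...   | true  = refl
...   | false = refl

module Counting {n : ℕ} {P : Fin n → Set} (P? : Decidable P) where

  members : List (Fin n)
  members = filter P? (allFin n)

  members-unique : Unique members
  members-unique = filter⁺ P? (allFin⁺ n)

  ∈-members : ∀ {z} → P z → z ∈ members
  ∈-members pz = ∈-filter⁺ P? (∈-allFin _) pz

  members-satisfy : ∀ {z} → z ∈ members → P z
  members-satisfy z∈ = proj₂ (∈-filter⁻ P? {xs = allFin n} z∈)

  count≡length : ∀ {L} → Unique L → (∀ z → P z → z ∈ L) → (∀ z → z ∈ L → P z) →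
                 length members ≡ length L
  count≡length uL P⊆L L⊆P =
    same-members⇒same-length members-unique uL (λ z∈ → P⊆L _ (members-satisfy z∈)) (λ z∈ → ∈-members (L⊆P _ z∈))

  exactly-three : length members ≡ 3 →
    Σ (Fin n) λ a → Σ (Fin n) λ b → Σ (Fin n) λ c →
      members ≡ a ∷ b ∷ c ∷ [] × P a × P b × P c × a ≢ b × a ≢ c × b ≢ c
  exactly-three three = split members refl three members-unique
    where
    split : ∀ xs → members ≡ xs → length xs ≡ 3 → Unique xs →
      Σ (Fin n) λ a → Σ (Fin n) λ b → Σ (Fin n) λ c →
        members ≡ a ∷ b ∷ c ∷ [] × P a × P b × P c × a ≢ b × a ≢ c × b ≢ c
    split (a ∷ b ∷ c ∷ []) eq refl ((a≢b ∷ a≢c ∷ []) ∷ (b≢c ∷ []) ∷ [] ∷ []) =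
      a , b , c , eq , sat (here refl) , sat (there (here refl)) , sat (there (there (here refl))) ,
      a≢b , a≢c , b≢c
      where
      sat : ∀ {z} → z ∈ a ∷ b ∷ c ∷ [] → P z
      sat z∈ = members-satisfy (subst (_ ∈_) (sym eq) z∈)

  -- If P has exactly three solutions, any three distinct solutions are all of them:
  -- otherwise filtering the solutions by "one of a, b, c" would keep three of
  -- them and drop at least one.
  three-exhaust : length members ≡ 3 → ∀ {a b c} → P a → P b → P c → a ≢ b → a ≢ c → b ≢ c →
                  ∀ {z} → P z → OneOf z a b c
  three-exhaust three {a} {b} {c} pa pb pc a≢b a≢c b≢c {z} pz with oneOf? z a b c
  ... | yes z∈abc = z∈abc
  ... | no z∉abc  = ⊥-elim (<-irrefl (trans kept-three (sym three)) drops-z)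
    where
    abc? : Decidable (λ y → OneOf y a b c)
    abc? y = oneOf? y a b c
    sat : ∀ {y} → OneOf y a b c → P y
    sat (inj₁ refl)        = pa
    sat (inj₂ (inj₁ refl)) = pb
    sat (inj₂ (inj₂ refl)) = pc
    kept-three : length (filter abc? members) ≡ 3
    kept-three = same-members⇒same-length (filter⁺ abc? members-unique) (triple-unique a≢b a≢c b≢c)
      (λ y∈ → oneOf⇒∈ (proj₂ (∈-filter⁻ abc? {xs = members} y∈)))
      (λ y∈ → ∈-filter⁺ abc? (∈-members (sat (∈⇒oneOf y∈))) (∈⇒oneOf y∈))
    drops-z : length (filter abc? members) < length members
    drops-z = filter-notAll abc? members (lose (∈-members pz) z∉abc)

closed-set-is-everything : (Γ : Graph) → Connected Γ → (S : Fin (Graph.n Γ) → Set) →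
  (∀ {x y} → S x → Graph.Adj Γ x y → S y) → ∀ {u} → S u → ∀ x → S x
closed-set-is-everything Γ connected S closed {u} Su x = along (connected u x) Su
  where
  along : ∀ {y z} → Star (Graph.Adj Γ) y z → S y → S z
  along done          Sy = Sy
  along (y~y′ ◅ path) Sy = along path (closed Sy y~y′)

module CubicGraph (Γ : Graph) (cubic : Cubic Γ) where
  open Graph Γ renaming (sym to adj-sym)
  open Counting using (count≡length)

  adj⇒≢ : ∀ {x y} → Adj x y → x ≢ y
  adj⇒≢ x~y refl = irrefl x~y

  record Claw (x a b c : Fin n) : Set where
    constructor claw
    field
      x~a : Adj x a
      x~b : Adj x b
      x~c : Adj x c
      a≢b : a ≢ b
      a≢c : a ≢ c
      b≢c : b ≢ c

  swap₁₂ : ∀ {x a b c} → Claw x a b c → Claw x b a c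
  swap₁₂ (claw x~a x~b x~c a≢b a≢c b≢c) = claw x~b x~a x~c (≢-sym a≢b) b≢c a≢c

  swap₂₃ : ∀ {x a b c} → Claw x a b c → Claw x a c b
  swap₂₃ (claw x~a x~b x~c a≢b a≢c b≢c) = claw x~a x~c x~b a≢c a≢b (≢-sym b≢c)

  claw-complete : ∀ {x a b c z} → Claw x a b c → Adj x z → OneOf z a b c
  claw-complete {x} (claw x~a x~b x~c a≢b a≢c b≢c) =
    Counting.three-exhaust (adj? x) (cubic x) x~a x~b x~c a≢b a≢c b≢c

  neighbourhood : ∀ x → Σ (Fin n) λ a → Σ (Fin n) λ b → Σ (Fin n) λ c →
                  nbrs Γ x ≡ a ∷ b ∷ c ∷ [] × Claw x a b c
  neighbourhood x with Counting.exactly-three (adj? x) (cubic x)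
  ... | a , b , c , nbrs≡ , x~a , x~b , x~c , a≢b , a≢c , b≢c =
    a , b , c , nbrs≡ , claw x~a x~b x~c a≢b a≢c b≢c

  ε-at-claw : ∀ {x a b c} → Claw x a b c → (dab : Dec (Adj a b)) (dac : Dec (Adj a c)) →
              ε Γ x a ≡ indicator dab + indicator dac
  ε-at-claw {x} {a} {b} {c} cl@(claw _ x~b x~c _ _ b≢c) dab dac = begin
    ε Γ x a                                     ≡⟨ count≡length common? unique-bc common⊆bc bc⊆common ⟩
    length (filter (adj? a) (b ∷ c ∷ []))       ≡⟨ length-filter-pair (adj? a) b c ⟩
    indicator (adj? a b) + indicator (adj? a c) ≡⟨ cong₂ _+_ (indicator-irrelevant (adj? a b) dab)
                                                              (indicator-irrelevant (adj? a c) dac) ⟩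
    indicator dab + indicator dac               ∎
    where
    open ≡-Reasoning
    common? : Decidable (λ w → Adj x w × Adj a w)
    common? w = adj? x w ×-dec adj? a w
    unique-bc : Unique (filter (adj? a) (b ∷ c ∷ []))
    unique-bc = filter⁺ (adj? a) ((b≢c ∷ []) ∷ [] ∷ [])
    common⊆bc : ∀ w → Adj x w × Adj a w → w ∈ filter (adj? a) (b ∷ c ∷ [])
    common⊆bc _ (x~w , a~w) with claw-complete cl x~w
    ... | inj₁ refl        = ⊥-elim (irrefl a~w)
    ... | inj₂ (inj₁ refl) = ∈-filter⁺ (adj? a) (here refl) a~w
    ... | inj₂ (inj₂ refl) = ∈-filter⁺ (adj? a) (there (here refl)) a~w
    bc⊆common : ∀ w → w ∈ filter (adj? a) (b ∷ c ∷ []) → Adj x w × Adj a w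
    bc⊆common _ w∈ with ∈-filter⁻ (adj? a) {xs = b ∷ c ∷ []} w∈
    ... | here refl , a~w         = x~b , a~w
    ... | there (here refl) , a~w = x~c , a~w

  signature-at-claw : ∀ {x a b c} → nbrs Γ x ≡ a ∷ b ∷ c ∷ [] → Claw x a b c →
    (dab : Dec (Adj a b)) (dac : Dec (Adj a c)) (dbc : Dec (Adj b c)) →
    signature Γ x ≡ sort ((indicator dab + indicator dac) ∷ (indicator dab + indicator dbc) ∷
                          (indicator dac + indicator dbc) ∷ [])
  signature-at-claw {x} {a} {b} {c} nbrs≡ cl dab dac dbc = begin
    signature Γ x                           ≡⟨ cong (λ ys → sort (map (ε Γ x) ys)) nbrs≡ ⟩
    sort (ε Γ x a ∷ ε Γ x b ∷ ε Γ x c ∷ []) ≡⟨ sort-cong εa εb εc ⟩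
    sort ((indicator dab + indicator dac) ∷ (indicator dab + indicator dbc) ∷
          (indicator dac + indicator dbc) ∷ []) ∎
    where
    open ≡-Reasoning
    sort-cong : ∀ {p q r p′ q′ r′} → p ≡ p′ → q ≡ q′ → r ≡ r′ →
                sort (p ∷ q ∷ r ∷ []) ≡ sort (p′ ∷ q′ ∷ r′ ∷ [])
    sort-cong refl refl refl = refl
    -- `map′` only changes the proof of a decision, not its outcome
    flip : ∀ {y z} → Dec (Adj y z) → Dec (Adj z y)
    flip = map′ adj-sym adj-sym
    εa : ε Γ x a ≡ indicator dab + indicator dac
    εa = ε-at-claw cl dab dac
    εb : ε Γ x b ≡ indicator dab + indicator dbc
    εb = ε-at-claw (swap₁₂ cl) (flip dab) dbc
    εc : ε Γ x c ≡ indicator dac + indicator dbc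
    εc = ε-at-claw (swap₁₂ (swap₂₃ cl)) (flip dac) (flip dbc)

  -- The local type of x: the number k of edges among its three neighbours,
  -- presented with the neighbours ordered so that the edges come first.
  data LocalType (x : Fin n) : ℕ → Set where
    type0 : ∀ {a b c} → Claw x a b c → ¬ Adj a b → ¬ Adj a c → ¬ Adj b c → LocalType x 0
    type1 : ∀ {a b c} → Claw x a b c → Adj a b   → ¬ Adj a c → ¬ Adj b c → LocalType x 1
    type2 : ∀ {a b c} → Claw x a b c → Adj a b   → Adj a c   → ¬ Adj b c → LocalType x 2
    type3 : ∀ {a b c} → Claw x a b c → Adj a b   → Adj a c   → Adj b c   → LocalType x 3

  typeSignature : ℕ → List ℕ
  typeSignature 0 = 0 ∷ 0 ∷ 0 ∷ []
  typeSignature 1 = 0 ∷ 1 ∷ 1 ∷ []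
  typeSignature 2 = 1 ∷ 1 ∷ 2 ∷ []
  typeSignature _ = 2 ∷ 2 ∷ 2 ∷ []

  Classification : Fin n → Set
  Classification x = Σ ℕ λ k → LocalType x k × signature Γ x ≡ typeSignature k

  classify : ∀ x → Classification x
  classify x with neighbourhood x
  ... | a , b , c , nbrs≡ , cl =
    by-edges cl (adj? a b) (adj? a c) (adj? b c) (signature-at-claw nbrs≡ cl (adj? a b) (adj? a c) (adj? b c))
    where
    by-edges : ∀ {a b c} → Claw x a b c → (dab : Dec (Adj a b)) (dac : Dec (Adj a c)) (dbc : Dec (Adj b c)) →
      signature Γ x ≡ sort ((indicator dab + indicator dac) ∷ (indicator dab + indicator dbc) ∷
                            (indicator dac + indicator dbc) ∷ []) →
      Classification x
    by-edges cl (yes ab) (yes ac) (yes bc) σ = 3 , type3 cl ab ac bc , σ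
    by-edges cl (yes ab) (yes ac) (no bc)  σ = 2 , type2 cl ab ac bc , σ
    by-edges cl (yes ab) (no ac)  (yes bc) σ = 2 , type2 (swap₁₂ cl) (adj-sym ab) bc ac , σ
    by-edges cl (no ab)  (yes ac) (yes bc) σ =
      2 , type2 (swap₁₂ (swap₂₃ cl)) (adj-sym ac) (adj-sym bc) ab , σ
    by-edges cl (yes ab) (no ac)  (no bc)  σ = 1 , type1 cl ab ac bc , σ
    by-edges cl (no ab)  (yes ac) (no bc)  σ = 1 , type1 (swap₂₃ cl) ac ab (λ cb → bc (adj-sym cb)) , σ
    by-edges cl (no ab)  (no ac)  (yes bc) σ =
      1 , type1 (swap₂₃ (swap₁₂ cl)) bc (λ ba → ab (adj-sym ba)) (λ ca → ac (adj-sym ca)) , σ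
    by-edges cl (no ab)  (no ac)  (no bc)  σ = 0 , type0 cl ab ac bc , σ

  -- Each triangle at x contains two edges at x, so the local type is half the
  -- sum of the signature; in particular it is determined by the signature.
  trianglesAt : List ℕ → ℕ
  trianglesAt σ = ⌊ sum σ /2⌋

  trianglesAt-type : ∀ {x k} → LocalType x k → trianglesAt (typeSignature k) ≡ k
  trianglesAt-type (type0 _ _ _ _) = refl
  trianglesAt-type (type1 _ _ _ _) = refl
  trianglesAt-type (type2 _ _ _ _) = refl
  trianglesAt-type (type3 _ _ _ _) = refl

  same-type : ∀ {x y k} → LocalType x k → signature Γ x ≡ typeSignature k →
              signature Γ y ≡ signature Γ x → LocalType y k
  same-type {x} {y} {k} tx σx σy≡σx with classify y
  ... | k′ , ty , σy = subst (LocalType y) k′≡k ty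
    where
    k′≡k : k′ ≡ k
    k′≡k = trans (sym (trianglesAt-type ty))
             (trans (cong trianglesAt (trans (sym σy) (trans σy≡σx σx))) (trianglesAt-type tx))

  type0-triangle-free : ∀ {u v w} → LocalType u 0 → Adj u v → Adj u w → ¬ Adj v w
  type0-triangle-free (type0 cl ¬ab ¬ac ¬bc) u~v u~w v~w =
    independent (claw-complete cl u~v) (claw-complete cl u~w) v~w
    where
    independent : ∀ {v w} → OneOf v _ _ _ → OneOf w _ _ _ → ¬ Adj v w
    independent (inj₁ refl)        (inj₁ refl)        = irrefl
    independent (inj₁ refl)        (inj₂ (inj₁ refl)) = ¬ab
    independent (inj₁ refl)        (inj₂ (inj₂ refl)) = ¬ac
    independent (inj₂ (inj₁ refl)) (inj₁ refl)        = λ ba → ¬ab (adj-sym ba)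
    independent (inj₂ (inj₁ refl)) (inj₂ (inj₁ refl)) = irrefl
    independent (inj₂ (inj₁ refl)) (inj₂ (inj₂ refl)) = ¬bc
    independent (inj₂ (inj₂ refl)) (inj₁ refl)        = λ ca → ¬ac (adj-sym ca)
    independent (inj₂ (inj₂ refl)) (inj₂ (inj₁ refl)) = λ cb → ¬bc (adj-sym cb)
    independent (inj₂ (inj₂ refl)) (inj₂ (inj₂ refl)) = irrefl

  -- If u has neighbours a, b, c with a ~ b, a ~ c and b ≁ c, then every edge
  -- among the neighbours of b has an end in {u, a}; so b is not of type 2,
  -- whose two edges among the neighbours span three vertices.
  no-type2 : Fin n → ¬ (∀ x → LocalType x 2)
  no-type2 u all-type2 with all-type2 u
  ... | type2 {a} {b} {c} clᵤ@(claw u~a u~b u~c _ _ b≢c) a~b a~c ¬bc with all-type2 b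
  ... | type2 {a′} {b′} {c′} (claw b~a′ b~b′ b~c′ a′≢b′ a′≢c′ b′≢c′) a′~b′ a′~c′ _ =
    no-three-in-two a′≢b′ a′≢c′ b′≢c′
      (edge-end b~a′ b~b′ a′~b′) (edge-end b~b′ b~a′ (adj-sym a′~b′)) (edge-end b~c′ b~a′ (adj-sym a′~c′))
    where
    not-b-or-c : ∀ {y} → Adj b y → y ≡ b ⊎ y ≡ c → ⊥
    not-b-or-c b~y (inj₁ refl) = irrefl b~y
    not-b-or-c b~y (inj₂ refl) = ¬bc b~y

    edge-end : ∀ {y z} → Adj b y → Adj b z → Adj y z → y ≡ u ⊎ y ≡ a
    edge-end {y} {z} b~y b~z y~z with y ≟ u | y ≟ a
    ... | yes y≡u | _       = inj₁ y≡u
    ... | no _    | yes y≡a = inj₂ y≡a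
    ... | no y≢u  | no y≢a  = ⊥-elim (z-impossible (claw-complete clᵦ b~z))
      where
      clᵦ : Claw b u a y
      clᵦ = claw (adj-sym u~b) (adj-sym a~b) b~y (adj⇒≢ u~a) (≢-sym y≢u) (≢-sym y≢a)
      clₐ : Claw a u b c
      clₐ = claw (adj-sym u~a) a~b a~c (adj⇒≢ u~b) (adj⇒≢ u~c) b≢c
      z-impossible : OneOf z u a y → ⊥
      z-impossible (inj₁ refl) with claw-complete clᵤ (adj-sym y~z)
      ... | inj₁ y≡a   = y≢a y≡a
      ... | inj₂ y∈bc = not-b-or-c b~y y∈bc
      z-impossible (inj₂ (inj₁ refl)) with claw-complete clₐ (adj-sym y~z)
      ... | inj₁ y≡u   = y≢u y≡u
      ... | inj₂ y∈bc = not-b-or-c b~y y∈bc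
      z-impossible (inj₂ (inj₂ refl)) = irrefl y~z

  -- If u and its neighbours a, b, c form a clique, then by connectivity these
  -- four vertices are the whole graph, and listing them gives Γ ≅ K₄.
  module Complete (connected : Connected Γ) {u a b c} (clᵤ : Claw u a b c)
                  (a~b : Adj a b) (a~c : Adj a c) (b~c : Adj b c) where
    open Claw clᵤ renaming (x~a to u~a; x~b to u~b; x~c to u~c)

    K : List (Fin n)
    K = u ∷ a ∷ b ∷ c ∷ []

    K-unique : Unique K
    K-unique = (adj⇒≢ u~a ∷ adj⇒≢ u~b ∷ adj⇒≢ u~c ∷ []) ∷ (a≢b ∷ a≢c ∷ []) ∷ (b≢c ∷ []) ∷ [] ∷ []

    via : ∀ {x p q r y} → Claw x p q r → p ∈ K → q ∈ K → r ∈ K → Adj x y → y ∈ K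
    via cl p∈K q∈K r∈K x~y with claw-complete cl x~y
    ... | inj₁ refl        = p∈K
    ... | inj₂ (inj₁ refl) = q∈K
    ... | inj₂ (inj₂ refl) = r∈K

    K-closed : ∀ {x y} → x ∈ K → Adj x y → y ∈ K
    K-closed (here refl) = via clᵤ (there (here refl)) (there (there (here refl))) (there (there (there (here refl))))
    K-closed (there (here refl)) =
      via (claw (adj-sym u~a) a~b a~c (adj⇒≢ u~b) (adj⇒≢ u~c) b≢c)
          (here refl) (there (there (here refl))) (there (there (there (here refl))))
    K-closed (there (there (here refl))) =
      via (claw (adj-sym u~b) (adj-sym a~b) b~c (adj⇒≢ u~a) (adj⇒≢ u~c) a≢c)
          (here refl) (there (here refl)) (there (there (there (here refl))))
    K-closed (there (there (there (here refl)))) =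
      via (claw (adj-sym u~c) (adj-sym a~c) (adj-sym b~c) (adj⇒≢ u~a) (adj⇒≢ u~b) a≢b)
          (here refl) (there (here refl)) (there (there (here refl)))
    K-closed (there (there (there (there ()))))

    everything : ∀ x → x ∈ K
    everything = closed-set-is-everything Γ connected (_∈ K) K-closed (here refl)

    adjacent : ∀ i j → i ≢ j → Adj (lookup K i) (lookup K j)
    adjacent 0F 0F i≢j = ⊥-elim (i≢j refl)
    adjacent 0F 1F _   = u~a
    adjacent 0F 2F _   = u~b
    adjacent 0F 3F _   = u~c
    adjacent 1F 0F _   = adj-sym u~a
    adjacent 1F 1F i≢j = ⊥-elim (i≢j refl)
    adjacent 1F 2F _   = a~b
    adjacent 1F 3F _   = a~c
    adjacent 2F 0F _   = adj-sym u~b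
    adjacent 2F 1F _   = adj-sym a~b
    adjacent 2F 2F i≢j = ⊥-elim (i≢j refl)
    adjacent 2F 3F _   = b~c
    adjacent 3F 0F _   = adj-sym u~c
    adjacent 3F 1F _   = adj-sym a~c
    adjacent 3F 2F _   = adj-sym b~c
    adjacent 3F 3F i≢j = ⊥-elim (i≢j refl)

    position : Fin n → Fin 4
    position x = index (everything x)

    lookup-position : ∀ x → lookup K (position x) ≡ x
    lookup-position x = sym (lookup-index (everything x))

    iso : Iso Adj K4-Adj
    iso = mk↔ₛ′ position (lookup K) (λ i → index-of-lookup K-unique (everything (lookup K i)) i refl) lookup-position ,
          λ x y → (λ x~y same → adj⇒≢ x~y (same-position same))
                , (λ differ → subst₂ Adj (lookup-position x) (lookup-position y) (adjacent _ _ differ))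
      where
      same-position : ∀ {x y} → position x ≡ position y → x ≡ y
      same-position {x} {y} e = trans (sym (lookup-position x)) (trans (cong (lookup K) e) (lookup-position y))

  K4-iso : ∀ {u} → Connected Γ → LocalType u 3 → Iso Adj K4-Adj
  K4-iso connected (type3 cl a~b a~c b~c) = Complete.iso connected cl a~b a~c b~c

  -- If every vertex has type 1, every vertex x lies on exactly one triangle
  -- {x, mate₁ x, mate₂ x} and has one further neighbour outer x.  The
  -- triangles partition the vertices; choosing the least vertex of each
  -- triangle enumerates them, giving the vertices of Λ.
  module Truncation (all-type1 : ∀ x → LocalType x 1) where

    record Type1 (x : Fin n) : Set where
      field
        mate₁ mate₂ outer : Fin n
        claw-at   : Claw x mate₁ mate₂ outer
        mates~    : Adj mate₁ mate₂
        mate₁≁out : ¬ Adj mate₁ outer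
        mate₂≁out : ¬ Adj mate₂ outer

    view : ∀ x → Type1 x
    view x with all-type1 x
    ... | type1 {m₁} {m₂} {o} cl m₁~m₂ m₁≁o m₂≁o = record
      { mate₁ = m₁ ; mate₂ = m₂ ; outer = o ; claw-at = cl ; mates~ = m₁~m₂ ; mate₁≁out = m₁≁o ; mate₂≁out = m₂≁o }

    mate₁ mate₂ outer : Fin n → Fin n
    mate₁ x = Type1.mate₁ (view x)
    mate₂ x = Type1.mate₂ (view x)
    outer x = Type1.outer (view x)

    module _ (x : Fin n) where
      open Type1 (view x) public using (claw-at; mates~; mate₁≁out; mate₂≁out)

    neighbour : ∀ {x z} → Adj x z → OneOf z (mate₁ x) (mate₂ x) (outer x)
    neighbour {x} = claw-complete (claw-at x)

    outer-no-common : ∀ {x z} → Adj x z → ¬ Adj (outer x) z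
    outer-no-common {x} x~z o~z with neighbour x~z
    ... | inj₁ refl        = mate₁≁out x (adj-sym o~z)
    ... | inj₂ (inj₁ refl) = mate₂≁out x (adj-sym o~z)
    ... | inj₂ (inj₂ refl) = irrefl o~z

    is-mate : ∀ {y x z} → Adj y x → Adj y z → Adj x z → x ≡ mate₁ y ⊎ x ≡ mate₂ y
    is-mate y~x y~z x~z with neighbour y~x
    ... | inj₁ x≡m₁        = inj₁ x≡m₁
    ... | inj₂ (inj₁ x≡m₂) = inj₂ x≡m₂
    ... | inj₂ (inj₂ refl) = ⊥-elim (outer-no-common y~z x~z)

    mates-adjacent : ∀ {y x w} → x ≡ mate₁ y ⊎ x ≡ mate₂ y → w ≡ mate₁ y ⊎ w ≡ mate₂ y → x ≢ w → Adj x w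
    mates-adjacent         (inj₁ refl) (inj₁ refl) x≢w = ⊥-elim (x≢w refl)
    mates-adjacent {y}     (inj₁ refl) (inj₂ refl) _   = mates~ y
    mates-adjacent {y}     (inj₂ refl) (inj₁ refl) _   = adj-sym (mates~ y)
    mates-adjacent         (inj₂ refl) (inj₂ refl) x≢w = ⊥-elim (x≢w refl)

    SameTriangle : Fin n → Fin n → Set
    SameTriangle x y = x ≡ y ⊎ (Adj x y × ∃ λ z → Adj x z × Adj y z)

    same⇒oneOf : ∀ {x y} → SameTriangle x y → OneOf y x (mate₁ x) (mate₂ x)
    same⇒oneOf (inj₁ refl) = inj₁ refl
    same⇒oneOf (inj₂ (x~y , z , x~z , y~z)) = inj₂ (is-mate x~y x~z y~z)

    oneOf⇒same : ∀ {x y} → OneOf y x (mate₁ x) (mate₂ x) → SameTriangle x y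
    oneOf⇒same         (inj₁ refl)        = inj₁ refl
    oneOf⇒same {x}     (inj₂ (inj₁ refl)) =
      inj₂ (Claw.x~a (claw-at x) , mate₂ x , Claw.x~b (claw-at x) , mates~ x)
    oneOf⇒same {x}     (inj₂ (inj₂ refl)) =
      inj₂ (Claw.x~b (claw-at x) , mate₁ x , Claw.x~a (claw-at x) , adj-sym (mates~ x))

    same-sym : ∀ {x y} → SameTriangle x y → SameTriangle y x
    same-sym (inj₁ x≡y)                   = inj₁ (sym x≡y)
    same-sym (inj₂ (x~y , z , x~z , y~z)) = inj₂ (adj-sym x~y , z , y~z , x~z)

    -- Transitivity: two distinct vertices sharing a triangle with y are the
    -- two mates of y, so they are adjacent with common neighbour y.
    same-trans : ∀ {x y w} → SameTriangle x y → SameTriangle y w → SameTriangle x w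
    same-trans (inj₁ refl) t = t
    same-trans t (inj₁ refl) = t
    same-trans {x} {y} {w} (inj₂ (x~y , z , x~z , y~z)) (inj₂ (y~w , z′ , y~z′ , w~z′)) with x ≟ w
    ... | yes x≡w = inj₁ x≡w
    ... | no x≢w  = inj₂ (mates-adjacent (is-mate (adj-sym x~y) y~z x~z) (is-mate y~w y~z′ w~z′) x≢w ,
                         y , x~y , adj-sym y~w)

    open Min (≤-totalOrder n) using (_⊓_; x⊓y≤x; x⊓y≤y; ⊓-sel)

    representative : Fin n → Fin n
    representative x = x ⊓ (mate₁ x ⊓ mate₂ x)

    representative-least : ∀ {x z} → SameTriangle x z → representative x ≤ z
    representative-least {x} t with same⇒oneOf t
    ... | inj₁ refl        = x⊓y≤x x (mate₁ x ⊓ mate₂ x)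
    ... | inj₂ (inj₁ refl) = ≤-trans (x⊓y≤y x (mate₁ x ⊓ mate₂ x)) (x⊓y≤x (mate₁ x) (mate₂ x))
    ... | inj₂ (inj₂ refl) = ≤-trans (x⊓y≤y x (mate₁ x ⊓ mate₂ x)) (x⊓y≤y (mate₁ x) (mate₂ x))

    representative-same : ∀ x → SameTriangle x (representative x)
    representative-same x with ⊓-sel x (mate₁ x ⊓ mate₂ x) | ⊓-sel (mate₁ x) (mate₂ x)
    ... | inj₁ r≡x | _        = oneOf⇒same (inj₁ r≡x)
    ... | inj₂ r≡m | inj₁ m≡m₁ = oneOf⇒same (inj₂ (inj₁ (trans r≡m m≡m₁)))
    ... | inj₂ r≡m | inj₂ m≡m₂ = oneOf⇒same (inj₂ (inj₂ (trans r≡m m≡m₂)))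

    representative-cong : ∀ {x y} → SameTriangle x y → representative x ≡ representative y
    representative-cong {x} {y} t =
      ≤-antisym (representative-least (same-trans t (representative-same y)))
                (representative-least (same-trans (same-sym t) (representative-same x)))

    representative-same⁻¹ : ∀ {x y} → representative x ≡ representative y → SameTriangle x y
    representative-same⁻¹ {x} {y} e =
      same-trans (subst (SameTriangle x) e (representative-same x)) (same-sym (representative-same y))

    corner? : Decidable (λ x → representative x ≡ x)
    corner? x = representative x ≟ x

    corners : List (Fin n)
    corners = filter corner? (allFin n)

    corners-unique : Unique corners
    corners-unique = filter⁺ corner? (allFin⁺ n)

    representative∈corners : ∀ x → representative x ∈ corners
    representative∈corners x =
      ∈-filter⁺ corner? (∈-allFin _) (sym (representative-cong (representative-same x)))

    -- The triangle containing x, as a position in corners.  It is used only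
    -- through the three properties below, so it is kept opaque.
    opaque
      triangleOf : Fin n → Fin (length corners)
      triangleOf x = index (representative∈corners x)

      triangleOf-same : ∀ {x y} → SameTriangle x y → triangleOf x ≡ triangleOf y
      triangleOf-same {x} {y} t = index-of-lookup corners-unique (representative∈corners x) (triangleOf y)
        (trans (representative-cong t) (lookup-index (representative∈corners y)))

      triangleOf-same⁻¹ : ∀ {x y} → triangleOf x ≡ triangleOf y → SameTriangle x y
      triangleOf-same⁻¹ {x} {y} e = representative-same⁻¹
        (trans (lookup-index (representative∈corners x))
               (trans (cong (lookup corners) e) (sym (lookup-index (representative∈corners y)))))

      triangleOf-corner : ∀ i → triangleOf (lookup corners i) ≡ i
      triangleOf-corner i = index-of-lookup corners-unique (representative∈corners (lookup corners i)) i
        (proj₂ (∈-filter⁻ corner? {xs = allFin n} (∈-lookup i)))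

    triangle-size : ∀ i → length (filter (λ x → triangleOf x ≟ i) (allFin n)) ≡ 3
    triangle-size i = count≡length (λ x → triangleOf x ≟ i) (triple-unique v≢m₁ v≢m₂ m₁≢m₂) in-triangle on-triangle
      where
      v : Fin n
      v = lookup corners i
      v≢m₁ : v ≢ mate₁ v
      v≢m₁ = adj⇒≢ (Claw.x~a (claw-at v))
      v≢m₂ : v ≢ mate₂ v
      v≢m₂ = adj⇒≢ (Claw.x~b (claw-at v))
      m₁≢m₂ : mate₁ v ≢ mate₂ v
      m₁≢m₂ = Claw.a≢b (claw-at v)
      in-triangle : ∀ z → triangleOf z ≡ i → z ∈ v ∷ mate₁ v ∷ mate₂ v ∷ []
      in-triangle z e = oneOf⇒∈ (same⇒oneOf (triangleOf-same⁻¹ (trans (triangleOf-corner i) (sym e))))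
      on-triangle : ∀ z → z ∈ v ∷ mate₁ v ∷ mate₂ v ∷ [] → triangleOf z ≡ i
      on-triangle _ z∈ = trans (sym (triangleOf-same (oneOf⇒same (∈⇒oneOf z∈)))) (triangleOf-corner i)

    -- x is the outer neighbour of outer x, since x and outer x have no common neighbour
    outer-involutive : ∀ x → outer (outer x) ≡ x
    outer-involutive x with neighbour (adj-sym (Claw.x~c (claw-at x)))
    ... | inj₁ x≡m₁ =
      ⊥-elim (outer-no-common (subst (λ t → Adj t (mate₂ (outer x))) (sym x≡m₁) (mates~ (outer x)))
                              (Claw.x~b (claw-at (outer x))))
    ... | inj₂ (inj₁ x≡m₂) =
      ⊥-elim (outer-no-common (subst (λ t → Adj t (mate₁ (outer x))) (sym x≡m₂) (adj-sym (mates~ (outer x))))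
                              (Claw.x~a (claw-at (outer x))))
    ... | inj₂ (inj₂ x≡o) = sym x≡o

    outer-leaves-triangle : ∀ x → triangleOf (outer x) ≢ triangleOf x
    outer-leaves-triangle x e with same⇒oneOf (triangleOf-same⁻¹ (sym e))
    ... | inj₁ o≡x        = adj⇒≢ (Claw.x~c (claw-at x)) (sym o≡x)
    ... | inj₂ (inj₁ o≡m₁) = Claw.a≢c (claw-at x) (sym o≡m₁)
    ... | inj₂ (inj₂ o≡m₂) = Claw.b≢c (claw-at x) (sym o≡m₂)

    Λ : CubicMultigraph
    Λ = record
      { nv        = length corners
      ; na        = n
      ; tail      = triangleOf
      ; inv       = outer
      ; inv-invol = outer-involutive
      ; inv-nofix = λ x o≡x → adj⇒≢ (Claw.x~c (claw-at x)) (sym o≡x)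
      ; noLoops   = outer-leaves-triangle
      ; out3      = triangle-size
      }

    truncation : IsoToTruncation Γ
    truncation = Λ , ↔-id _ , λ x y → adj⇒trunc , trunc⇒adj
      where
      adj⇒trunc : ∀ {x y} → Adj x y → TruncAdj Λ x y
      adj⇒trunc x~y with neighbour x~y
      ... | inj₁ refl        = inj₁ (adj⇒≢ x~y , triangleOf-same (oneOf⇒same (inj₂ (inj₁ refl))))
      ... | inj₂ (inj₁ refl) = inj₁ (adj⇒≢ x~y , triangleOf-same (oneOf⇒same (inj₂ (inj₂ refl))))
      ... | inj₂ (inj₂ refl) = inj₂ refl
      trunc⇒adj : ∀ {x y} → TruncAdj Λ x y → Adj x y
      trunc⇒adj {x} (inj₂ refl) = Claw.x~c (claw-at x)
      trunc⇒adj (inj₁ (x≢y , same)) with triangleOf-same⁻¹ same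
      ... | inj₁ x≡y       = ⊥-elim (x≢y x≡y)
      ... | inj₂ (x~y , _) = x~y

theorem4p1 : (Γ : Graph) → Connected Γ → Cubic Γ → HasGirth3 Γ → GirthRegular Γ →
    Iso (Graph.Adj Γ) K4-Adj
      ⊎ (HasSignature Γ (0 ∷ 1 ∷ 1 ∷ []) × IsoToTruncation Γ)
theorem4p1 Γ connected cubic (u , v , w , u~v , v~w , u~w) regular = conclude (classify u)
  where
  open CubicGraph Γ cubic
  everywhere : ∀ {k} → LocalType u k → signature Γ u ≡ typeSignature k → ∀ x → LocalType x k
  everywhere t σ x = same-type t σ (regular x u)
  conclude : Classification u →
    Iso (Graph.Adj Γ) K4-Adj ⊎ (HasSignature Γ (0 ∷ 1 ∷ 1 ∷ []) × IsoToTruncation Γ)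
  conclude (0 , t , _) = ⊥-elim (type0-triangle-free t u~v u~w v~w)
  conclude (1 , t , σ) = inj₂ ((λ x → trans (regular x u) σ) , Truncation.truncation (everywhere t σ))
  conclude (2 , t , σ) = ⊥-elim (no-type2 u (everywhere t σ))
  conclude (3 , t , _) = inj₁ (K4-iso connected t)
  conclude (suc (suc (suc (suc _))) , () , _)
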